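{- Let $M$ be a one-sided Turing machine with tape alphabet $\{0,1\}$, and let $f$ be the partial function on $\mathbb{N}$ computed by $M$ with binary input and binary output (conventions below). Then $f$ consists of strips of functions of the form $y \mapsto a + y$. Precisely: for every $i \in \mathbb{N}$ on which $f$ is defined, there is an integer $b \geq 1$ such that for every $x \in \mathbb{N}$, $f$ is defined on $i + b\cdot x$ and $$f(i + b\cdot x) = (i + b\cdot x) + a_i, \qquad \text{where } a_i = f(i) - i \in \mathbb{Z}.$$ That is, the restriction of $f$ to the strip $\{i + b\cdot x \mid x \in \mathbb{N}\}$ is the function $y \mapsto y + a_i$.
   Context: A one-sided Turing machine has finitely many states, tape alphabet $\{0,1\}$ (with $0$ the blank), and a tape that is infinite to the left but bounded on the right: there is a rightmost cell. A deterministic transition table maps each pair (state, symbol read) to a triple (symbol to write, move left or right, next state). At each step the machine reads the cell under the head, writes a symbol, moves the head one cell and changes state. There is no halting state: the computation halts exactly when the head is on the rightmost cell and is instructed to move right, so that it drops off the tape. Binary input/output convention: the input $n \in \mathbb{N}$ is written on the tape in binary, with its least significant bit in the rightmost cell and all other cells $0$. The head starts on the rightmost cell in a fixed initial state. If the computation halts, the output is the natural number whose binary representation is the final tape content (least significant bit in the rightmost cell; the content is $0$ in all but finitely many cells). $f(n)$ is this output if the computation on $n$ halts and is undefined otherwise. A strip is a subset of $\mathbb{N}$ of the form $\{a + b\cdot n \mid n \in \mathbb{N}\}$ for fixed natural numbers $a, b$. A strip of a function $f$ is the restriction of $f$ to a subdomain that is a strip. -}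

module Defs where

open import Data.Nat using (ℕ; zero; suc; _≡ᵇ_; _%_; _/_)
open import Data.Bool using (Bool; true; false; if_then_else_)
open import Data.Fin using (Fin)
open import Data.Product using (_×_; _,_; ∃; ∃-syntax)
open import Data.Sum using (_⊎_; inj₁; inj₂)
open import Relation.Binary.PropositionalEquality using (_≡_)

-- Tape alphabet {0,1} is Bool (false = 0 = blank, true = 1).
-- Head moves.
data Dir : Set where
  L R : Dir

-- Cells are addressed by their distance from the rightmost cell:
-- position 0 is the rightmost cell, moving left increases the position.
record TM (k : ℕ) : Set where
  field
    δ     : Fin k → Bool → Bool × Dir × Fin k
    start : Fin k

Tape : Set
Tape = ℕ → Bool

record Config (k : ℕ) : Set where
  constructor config
  field
    state : Fin k
    pos   : ℕ
    tape  : Tape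

write : Tape → ℕ → Bool → Tape
write T p w j = if j ≡ᵇ p then w else T j

-- One step: either the machine drops off the right end (inj₂ final tape)
-- or it continues with a new configuration (inj₁).
step : ∀ {k} → TM k → Config k → Config k ⊎ Tape
step M (config s p T) with TM.δ M s (T p)
... | (w , R , q) with p
...   | zero  = inj₂ (write T zero w)
...   | suc p' = inj₁ (config q p' (write T (suc p') w))
step M (config s p T) | (w , L , q) = inj₁ (config q (suc p) (write T p w))

run : ∀ {k} → TM k → ℕ → Config k → Config k ⊎ Tape
run M zero c = inj₁ c
run M (suc t) c with step M c
... | inj₁ c' = run M t c'
... | inj₂ T  = inj₂ T

bit : ℕ → ℕ → Bool
bit n zero    = (n % 2) ≡ᵇ 1
bit n (suc j) = bit (n / 2) j

init : ∀ {k} → TM k → ℕ → Config k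
init M n = config (TM.start M) zero (bit n)

Output : ∀ {k} → TM k → ℕ → ℕ → Set
Output M n m = ∃[ t ] ∃[ T ] ((run M t (init M n) ≡ inj₂ T) × (∀ j → T j ≡ bit m j))

module Submission where

open import Defs
open import Data.Nat using (ℕ; _+_; _*_; _≥_)
open import Data.Integer using (ℤ; +_; _-_) renaming (_+_ to _+ℤ_)
open import Data.Product using (_×_; _,_; ∃; ∃-syntax)
open import Relation.Binary.PropositionalEquality using (_≡_)

open import Data.Nat using (zero; suc; _<_; _≤_; _^_; _/_; _%_; _≡ᵇ_; z≤n; s≤s)
open import Data.Empty using (⊥-elim)
open import Data.Unit using (tt)
open import Data.Nat.Properties
open import Data.Nat.DivMod
open import Data.Nat.Divisibility using (divides-refl)
open import Data.Bool using (true; false; if_then_else_)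
open import Data.Sum using (_⊎_; inj₁; inj₂)
open import Relation.Nullary using (yes; no)
open import Relation.Binary.PropositionalEquality
  using (refl; sym; trans; cong; cong₂; subst; module ≡-Reasoning)
import Data.Integer.Solver as ℤ-Solver

-- A run that halts after t steps never moves the head beyond cell t - 1, so it
-- only reads and writes the t low-order bits of the tape.  Adding 2^t * x to
-- the input changes only the bits from t on; the same run therefore halts on
-- i + 2^t * x, with the same low bits as on i and with the high bits of its
-- input untouched.  On input i those high bits are the high bits of f(i), so
-- f(i + 2^t * x) = f(i) + 2^t * x, i.e. the strip of period b = 2^t works.

AgreeBelow : ℕ → Tape → Tape → Set
AgreeBelow P U V = ∀ j → j < P → U j ≡ V j

AgreeFrom : ℕ → Tape → Tape → Set
AgreeFrom P U V = ∀ j → P ≤ j → U j ≡ V j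

%2≡bit0 : ∀ n → n % 2 ≡ (if bit n 0 then 1 else 0)
%2≡bit0 n with n % 2 | m%n<n n 2
... | 0           | _             = refl
... | 1           | _             = refl
... | suc (suc _) | s≤s (s≤s ())

bit-injective : ∀ m n → (∀ j → bit m j ≡ bit n j) → m ≡ n
bit-injective m n = bounded (m + n) m n (m≤m+n m n) (m≤n+m n m)
  where
  open ≡-Reasoning

  /2≤ : ∀ {m bound} → m ≤ suc bound → m / 2 ≤ bound
  /2≤ {zero}  _      = z≤n
  /2≤ {suc m} m≤1+b = ≤-pred (≤-trans (m/n<m (suc m) 2 (s≤s (s≤s z≤n))) m≤1+b)

  bounded : ∀ bound m n → m ≤ bound → n ≤ bound →
            (∀ j → bit m j ≡ bit n j) → m ≡ n
  bounded zero        zero zero z≤n z≤n _ = refl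
  bounded (suc bound) m n m≤ n≤ same = begin
    m                   ≡⟨ m≡m%n+[m/n]*n m 2 ⟩
    m % 2 + (m / 2) * 2 ≡⟨ cong₂ (λ r q → r + q * 2) lowest halves ⟩
    n % 2 + (n / 2) * 2 ≡⟨ sym (m≡m%n+[m/n]*n n 2) ⟩
    n                   ∎
    where
    lowest : m % 2 ≡ n % 2
    lowest = trans (%2≡bit0 m) (trans (cong (if_then 1 else 0) (same 0)) (sym (%2≡bit0 n)))
    halves : m / 2 ≡ n / 2
    halves = bounded bound (m / 2) (n / 2) (/2≤ m≤) (/2≤ n≤) (λ j → same (suc j))

2^suc*≡2^*·2 : ∀ t x → 2 ^ suc t * x ≡ (2 ^ t * x) * 2
2^suc*≡2^*·2 t x = trans (*-assoc 2 (2 ^ t) x) (*-comm 2 (2 ^ t * x))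

+-2^suc*-/2 : ∀ n t x → (n + 2 ^ suc t * x) / 2 ≡ n / 2 + 2 ^ t * x
+-2^suc*-/2 n t x = begin
  (n + 2 ^ suc t * x) / 2     ≡⟨ cong (λ m → (n + m) / 2) (2^suc*≡2^*·2 t x) ⟩
  (n + (2 ^ t * x) * 2) / 2   ≡⟨ +-distrib-/-∣ʳ n (divides-refl (2 ^ t * x)) ⟩
  n / 2 + (2 ^ t * x) * 2 / 2 ≡⟨ cong (λ m → n / 2 + m) (m*n/n≡m (2 ^ t * x) 2) ⟩
  n / 2 + 2 ^ t * x           ∎
  where open ≡-Reasoning

+-2^suc*-%2 : ∀ n t x → (n + 2 ^ suc t * x) % 2 ≡ n % 2
+-2^suc*-%2 n t x =
  trans (cong (λ m → (n + m) % 2) (2^suc*≡2^*·2 t x)) ([m+kn]%n≡m%n n (2 ^ t * x) 2)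

bit-+-2^*-agreeBelow : ∀ t n x → AgreeBelow t (bit (n + 2 ^ t * x)) (bit n)
bit-+-2^*-agreeBelow (suc t) n x zero    _         = cong (_≡ᵇ 1) (+-2^suc*-%2 n t x)
bit-+-2^*-agreeBelow (suc t) n x (suc j) (s≤s j<t) =
  trans (cong (λ m → bit m j) (+-2^suc*-/2 n t x)) (bit-+-2^*-agreeBelow t (n / 2) x j j<t)

agreeFrom-+-2^* : ∀ t m n x → AgreeFrom t (bit m) (bit n) →
                  AgreeFrom t (bit (m + 2 ^ t * x)) (bit (n + 2 ^ t * x))
agreeFrom-+-2^* zero    m n x same j _ rewrite bit-injective m n (λ j → same j z≤n) = refl
agreeFrom-+-2^* (suc t) m n x same (suc j) (s≤s t≤j) = begin
  bit ((m + 2 ^ suc t * x) / 2) j ≡⟨ cong (λ z → bit z j) (+-2^suc*-/2 m t x) ⟩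
  bit (m / 2 + 2 ^ t * x) j       ≡⟨ agreeFrom-+-2^* t (m / 2) (n / 2) x
                                       (λ j t≤j → same (suc j) (s≤s t≤j)) j t≤j ⟩
  bit (n / 2 + 2 ^ t * x) j       ≡⟨ cong (λ z → bit z j) (+-2^suc*-/2 n t x) ⟨
  bit ((n + 2 ^ suc t * x) / 2) j ∎
  where open ≡-Reasoning

-- U and V are the current tapes of two runs started on A and B respectively.
record Coupled (P : ℕ) (A B U V : Tape) : Set where
  field
    agree  : AgreeBelow P U V
    frameˡ : AgreeFrom P U A
    frameʳ : AgreeFrom P V B
open Coupled

write-agreeFrom : ∀ {P U V p} w → p < P → AgreeFrom P U V → AgreeFrom P (write U p w) V
write-agreeFrom {P} {p = p} w p<P same j P≤j with j ≡ᵇ p | ≡ᵇ⇒≡ j p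
... | false | _   = same j P≤j
... | true  | j≡p = ⊥-elim (<⇒≱ p<P (subst (P ≤_) (j≡p tt) P≤j))

write-coupled : ∀ {P A B U V p} w → p < P → Coupled P A B U V →
                Coupled P A B (write U p w) (write V p w)
write-coupled {p = p} w p<P c = record
  { agree  = agree′
  ; frameˡ = write-agreeFrom w p<P (frameˡ c)
  ; frameʳ = write-agreeFrom w p<P (frameʳ c)
  }
  where
  agree′ : AgreeBelow _ (write _ p w) (write _ p w)
  agree′ j j<P with j ≡ᵇ p
  ... | true  = refl
  ... | false = agree c j j<P

module Simulation {k : ℕ} (M : TM k) (P : ℕ) (A B : Tape) where

  data Lockstep (p : ℕ) : Config k ⊎ Tape → Config k ⊎ Tape → Set where
    running : ∀ {s q U V} → q ≤ suc p → Coupled P A B U V →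
              Lockstep p (inj₁ (config s q U)) (inj₁ (config s q V))
    halted  : ∀ {U V} → Coupled P A B U V → Lockstep p (inj₂ U) (inj₂ V)

  step-lockstep : ∀ s p {U V} → p < P → Coupled P A B U V →
                  Lockstep p (step M (config s p U)) (step M (config s p V))
  step-lockstep s p {U} {V} p<P c rewrite agree c p p<P with TM.δ M s (V p)
  ... | w , L , q = running ≤-refl (write-coupled w p<P c)
  step-lockstep s zero     p<P c | w , R , q = halted (write-coupled w p<P c)
  step-lockstep s (suc p′) p<P c | w , R , q =
    running (m≤n⇒m≤1+n (n≤1+n p′)) (write-coupled w p<P c)

  run-lockstep : ∀ t s p {U V W} → p + t ≤ P → Coupled P A B U V →
                 run M t (config s p U) ≡ inj₂ W →
                 ∃[ W′ ] (run M t (config s p V) ≡ inj₂ W′ × Coupled P A B W W′)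
  run-lockstep zero    _ _ _ _ ()
  run-lockstep (suc t) s p {U} {V} p+1+t≤P c halts
    with step M (config s p U) | step M (config s p V) | step-lockstep s p p<P c
    where
    p<P : p < P
    p<P = ≤-trans (s≤s (m≤m+n p t)) (subst (_≤ P) (+-suc p t) p+1+t≤P)
  ... | inj₁ (config q p′ _) | inj₁ _ | running p′≤1+p c′ =
    run-lockstep t q p′
      (≤-trans (+-monoˡ-≤ t p′≤1+p) (subst (_≤ P) (+-suc p t) p+1+t≤P)) c′ halts
  ... | inj₂ _ | inj₂ W′ | halted c′ with halts
  ...   | refl = W′ , refl , c′

halting-translate : ∀ {k} (M : TM k) {i fi t T} → run M t (init M i) ≡ inj₂ T →
                    (∀ j → T j ≡ bit fi j) →
                    ∀ x → Output M (i + 2 ^ t * x) (fi + 2 ^ t * x)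
halting-translate M {i} {fi} {t} halts output x
  with Simulation.run-lockstep M t (bit i) (bit (i + 2 ^ t * x))
         t (TM.start M) zero ≤-refl coupled₀ halts
  where
  coupled₀ : Coupled t (bit i) (bit (i + 2 ^ t * x)) (bit i) (bit (i + 2 ^ t * x))
  coupled₀ = record
    { agree  = λ j j<t → sym (bit-+-2^*-agreeBelow t i x j j<t)
    ; frameˡ = λ _ _ → refl
    ; frameʳ = λ _ _ → refl
    }
... | T′ , halts′ , c = t , T′ , halts′ , output′
  where
  highBits : AgreeFrom t (bit i) (bit fi)
  highBits j t≤j = trans (sym (frameˡ c j t≤j)) (output j)

  output′ : ∀ j → T′ j ≡ bit (fi + 2 ^ t * x) j
  output′ j with j <? t
  ... | yes j<t = trans (sym (agree c j j<t))
                    (trans (output j) (sym (bit-+-2^*-agreeBelow t fi x j j<t)))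
  ... | no j≮t  = trans (frameʳ c j (≮⇒≥ j≮t))
                    (agreeFrom-+-2^* t i fi x highBits j (≮⇒≥ j≮t))

+[n+c]≡+[m+c]+[+n-+m] : ∀ m n c → + (n + c) ≡ + (m + c) +ℤ (+ n - + m)
+[n+c]≡+[m+c]+[+n-+m] m n c =
  solve 3 (λ m n c → n :+ c := (m :+ c) :+ (n :- m)) refl (+ m) (+ n) (+ c)
  where open ℤ-Solver.+-*-Solver

theorem1 : ∀ {k : ℕ} (M : TM k) (i fi : ℕ) → Output M i fi →
    ∃[ b ] (b ≥ 1 × (∀ (x : ℕ) → ∃[ y ] (Output M (i + b * x) y ×
      (+ y ≡ (+ (i + b * x)) +ℤ ((+ fi) - (+ i))))))
theorem1 M i fi (t , T , halts , output) =
  2 ^ t , m^n>0 2 t , λ x →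
    fi + 2 ^ t * x ,
    halting-translate M {i} {fi} {t} halts output x ,
    +[n+c]≡+[m+c]+[+n-+m] i fi (2 ^ t * x)
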